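{- Let $a_0,\ldots,a_{15}\in\mathbb{Z}$, define $b_i=(a_i+a_{i+8})+(a_{i+4}+a_{i+12})$ ($0\le i\le3$) and $d_i=a_i-a_{i+8}$ ($0\le i\le 7$), and let $d=(d_0+d_2)(d_4+d_6)+(d_1+d_3)(d_5+d_7)$ and $d^*=d_0d_2+d_4d_6+d_1d_3+d_5d_7$. Suppose $b_0+b_2\not\equiv b_1+b_3\pmod 2$ and $d\equiv1\pmod 2$. Then, writing $\bm d=(d_0,\ldots,d_7)$: (1) if $d^*\equiv 0\pmod 2$, then $F(\bm d)^2\in\{(4m-1)^2(8n+1)\mid m,n\in\mathbb{Z},\ m\ge1,\ m\not\equiv n\pmod 2\}$; (2) if $d^*\equiv1\pmod 2$, then $F(\bm d)^2\in\{(4m-1)^2(8n+1)\mid m,n\in\mathbb{Z},\ m\ge1,\ m\equiv n\pmod 2\}$.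
   Context: For $k\in\{0,1\}$ let $f_k(x,y,z,w)=x^2+y^2+(-1)^kz^2+(-1)^kw^2$, and $F(w_0,\ldots,w_7)=f_0(w_0-w_2,w_4-w_6,w_1-w_3,w_5-w_7)\,f_1(w_0+w_2,w_4+w_6,w_1+w_3,w_5+w_7)$. -}

module Defs where

open import Data.Nat using (ℕ)
open import Data.Fin using (Fin; #_)
import Data.Fin
open import Data.Integer using (ℤ; +_; _+_; _-_; _*_; -_; _≥_)
open import Data.Integer.Divisibility using (_∣_)
open import Data.Product using (Σ; ∃; _×_)
open import Relation.Binary.PropositionalEquality using (_≡_)
open import Relation.Nullary using (¬_)

infix 4 _≡₂_
_≡₂_ : ℤ → ℤ → Set
x ≡₂ y = + 2 ∣ (x - y)

f₀ : ℤ → ℤ → ℤ → ℤ → ℤ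
f₀ x y z w = x * x + y * y + z * z + w * w

f₁ : ℤ → ℤ → ℤ → ℤ → ℤ
f₁ x y z w = x * x + y * y - z * z - w * w

F : (Fin 8 → ℤ) → ℤ
F w = f₀ (w (# 0) - w (# 2)) (w (# 4) - w (# 6)) (w (# 1) - w (# 3)) (w (# 5) - w (# 7))
    * f₁ (w (# 0) + w (# 2)) (w (# 4) + w (# 6)) (w (# 1) + w (# 3)) (w (# 5) + w (# 7))

bvec : (Fin 16 → ℤ) → Fin 4 → ℤ
bvec a Fin.zero = (a (# 0) + a (# 8)) + (a (# 4) + a (# 12))
bvec a (Fin.suc Fin.zero) = (a (# 1) + a (# 9)) + (a (# 5) + a (# 13))
bvec a (Fin.suc (Fin.suc Fin.zero)) = (a (# 2) + a (# 10)) + (a (# 6) + a (# 14))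
bvec a (Fin.suc (Fin.suc (Fin.suc Fin.zero))) = (a (# 3) + a (# 11)) + (a (# 7) + a (# 15))

dvec : (Fin 16 → ℤ) → Fin 8 → ℤ
dvec a i = a (i Data.Fin.↑ˡ 8) - a (8 Data.Fin.↑ʳ i)

dval : (Fin 8 → ℤ) → ℤ
dval e = (e (# 0) + e (# 2)) * (e (# 4) + e (# 6)) + (e (# 1) + e (# 3)) * (e (# 5) + e (# 7))

dstar : (Fin 8 → ℤ) → ℤ
dstar e = e (# 0) * e (# 2) + e (# 4) * e (# 6) + e (# 1) * e (# 3) + e (# 5) * e (# 7)

InSetOdd : ℤ → Set
InSetOdd x = ∃ λ (m : ℤ) → ∃ λ (n : ℤ) →
  (m ≥ + 1) × (¬ (m ≡₂ n)) × (x ≡ (+ 4 * m - + 1) * (+ 4 * m - + 1) * (+ 8 * n + + 1))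

InSetEven : ℤ → Set
InSetEven x = ∃ λ (m : ℤ) → ∃ λ (n : ℤ) →
  (m ≥ + 1) × (m ≡₂ n) × (x ≡ (+ 4 * m - + 1) * (+ 4 * m - + 1) * (+ 8 * n + + 1))

module Submission where

-- With x = d₀ + d₂, y = d₄ + d₆, z = d₁ + d₃, w = d₅ + d₇ one has F(d) = (f₀(x,y,z,w) − 4d*) f₁(x,y,z,w).
-- The hypotheses say that xy + zw and x + y − z − w are odd, i.e. exactly one of x, y, z, w is even,
-- say 2g. As odd squares are 1 mod 8, f₀(x,y,z,w) = 8V + 3 + 4g² and f₁(x,y,z,w) = ±(4g² − 1 + 8U),
-- so the first factor of F is 4m − 1 with m ≡ 1 + g² − d* (mod 2), and m ≥ 1 because this factor is
-- a sum of squares; moreover f₁² = 8n + 1 with n ≡ g² (mod 2). Hence m − n ≡ 1 − d* (mod 2).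

open import Defs
open import Data.Fin using (Fin; #_)
open import Data.Integer using (ℤ; +_; -[1+_]; 0ℤ; _+_; _*_; -_; _-_; _≤_; +≤+; _%ℕ_; _/ℕ_)
open import Data.Integer.DivMod using (n%ℕd<d; a≡a%ℕn+[a/ℕn]*n)
open import Data.Integer.Properties using (+-comm; +-mono-≤; +◃n≡+n)
open import Data.Integer.Divisibility using (_∣_; divides)
import Data.Integer.Divisibility.Signed as Signed
open import Data.Integer.Tactic.RingSolver using (solve-∀)
open import Data.Nat using (zero; suc; z≤n; s≤s)
import Data.Nat as ℕ
open import Data.Parity using (Parity; 0ℙ; 1ℙ)
open import Data.Product using (_×_; _,_; ∃; ∃₂)
open import Data.Empty using (⊥-elim)
open import Function using (_∘_)
open import Relation.Nullary using (¬_)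
open import Relation.Binary.PropositionalEquality using (_≡_; refl; sym; trans; cong; cong₂; subst)

2∤1 : ¬ (+ 2 ∣ + 1)
2∤1 (divides zero ())
2∤1 (divides (suc _) ())

signed : ∀ i → + 2 ∣ i → + 2 Signed.∣ i
signed i = Signed.∣ᵤ⇒∣ {i = i}

2∣i⇒2∣j : ∀ {i j} → ∃ (λ k → i ≡ k * + 2 + j) → + 2 ∣ i → + 2 ∣ j
2∣i⇒2∣j {i} {j} (k , refl) h = Signed.∣⇒∣ᵤ (Signed.∣m+n∣m⇒∣n (signed i h) (Signed.divides k refl))

2∣j⇒2∣i : ∀ {i j} → ∃ (λ k → i ≡ k * + 2 + j) → + 2 ∣ j → + 2 ∣ i
2∣j⇒2∣i {i} {j} (k , refl) h = Signed.∣⇒∣ᵤ (Signed.∣m∣n⇒∣m+n (Signed.divides k refl) (signed j h))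

≡₂0⇒2∤1-i : ∀ i → i ≡₂ + 0 → ¬ (+ 2 ∣ + 1 - i)
≡₂0⇒2∤1-i i i≡₂0 h = 2∤1 (subst (+ 2 ∣_) (cancel i)
  (Signed.∣⇒∣ᵤ (Signed.∣m∣n⇒∣m+n (signed (+ 1 - i) h) (signed (i - + 0) i≡₂0))))
  where
  cancel : ∀ i → (+ 1 - i) + (i - + 0) ≡ + 1
  cancel = solve-∀

≡₂1⇒2∣1-i : ∀ i → i ≡₂ + 1 → + 2 ∣ + 1 - i
≡₂1⇒2∣1-i i i≡₂1 = subst (+ 2 ∣_) (negate i) (Signed.∣⇒∣ᵤ (Signed.∣m⇒∣-m (signed (i - + 1) i≡₂1)))
  where
  negate : ∀ i → - (i - + 1) ≡ + 1 - i
  negate = solve-∀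

⟦_⟧ : Parity → ℤ
⟦ 0ℙ ⟧ = + 0
⟦ 1ℙ ⟧ = + 1

split-parity : ∀ i → ∃₂ λ k p → i ≡ k * + 2 + ⟦ p ⟧
split-parity i with i %ℕ 2 | n%ℕd<d i 2 | a≡a%ℕn+[a/ℕn]*n i 2
... | 0           | _            | i≡ = i /ℕ 2 , 0ℙ , trans i≡ (+-comm (+ 0) (i /ℕ 2 * + 2))
... | 1           | _            | i≡ = i /ℕ 2 , 1ℙ , trans i≡ (+-comm (+ 1) (i /ℕ 2 * + 2))
... | suc (suc _) | s≤s (s≤s ()) | _

odd-square : ∀ k → ∃ λ t → (k * + 2 + + 1) * (k * + 2 + + 1) ≡ + 8 * t + + 1
odd-square k with split-parity k
... | j , 0ℙ , refl = j * j * + 2 + j , even-case j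
  where
  even-case : ∀ j → ((j * + 2 + + 0) * + 2 + + 1) * ((j * + 2 + + 0) * + 2 + + 1) ≡ + 8 * (j * j * + 2 + j) + + 1
  even-case = solve-∀
... | j , 1ℙ , refl = j * j * + 2 + j * + 3 + + 1 , odd-case j
  where
  odd-case : ∀ j → ((j * + 2 + + 1) * + 2 + + 1) * ((j * + 2 + + 1) * + 2 + + 1) ≡ + 8 * (j * j * + 2 + j * + 3 + + 1) + + 1
  odd-case = solve-∀

even-square : ∀ g → (g * + 2 + + 0) * (g * + 2 + + 0) ≡ + 4 * (g * g)
even-square = solve-∀

data OneEven : Parity → Parity → Parity → Parity → Set where
  even₁ : OneEven 0ℙ 1ℙ 1ℙ 1ℙ
  even₂ : OneEven 1ℙ 0ℙ 1ℙ 1ℙ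
  even₃ : OneEven 1ℙ 1ℙ 0ℙ 1ℙ
  even₄ : OneEven 1ℙ 1ℙ 1ℙ 0ℙ

one-even : ∀ p q r s → + 2 ∣ ⟦ p ⟧ * ⟦ q ⟧ + ⟦ r ⟧ * ⟦ s ⟧ - + 1 →
           ¬ (+ 2 ∣ ⟦ p ⟧ + ⟦ q ⟧ - ⟦ r ⟧ - ⟦ s ⟧) → OneEven p q r s
one-even 0ℙ 1ℙ 1ℙ 1ℙ _ _ = even₁
one-even 1ℙ 0ℙ 1ℙ 1ℙ _ _ = even₂
one-even 1ℙ 1ℙ 0ℙ 1ℙ _ _ = even₃
one-even 1ℙ 1ℙ 1ℙ 0ℙ _ _ = even₄
one-even 0ℙ 0ℙ 1ℙ 1ℙ _ odd = ⊥-elim (odd (divides 1 refl))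
one-even 1ℙ 1ℙ 0ℙ 0ℙ _ odd = ⊥-elim (odd (divides 1 refl))
-- ∣ compares absolute values, so 2∤1 also refutes 2 ∣ -1.
one-even 0ℙ 0ℙ 0ℙ 0ℙ even _ = ⊥-elim (2∤1 even)
one-even 0ℙ 0ℙ 0ℙ 1ℙ even _ = ⊥-elim (2∤1 even)
one-even 0ℙ 0ℙ 1ℙ 0ℙ even _ = ⊥-elim (2∤1 even)
one-even 0ℙ 1ℙ 0ℙ 0ℙ even _ = ⊥-elim (2∤1 even)
one-even 0ℙ 1ℙ 0ℙ 1ℙ even _ = ⊥-elim (2∤1 even)
one-even 0ℙ 1ℙ 1ℙ 0ℙ even _ = ⊥-elim (2∤1 even)
one-even 1ℙ 0ℙ 0ℙ 0ℙ even _ = ⊥-elim (2∤1 even)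
one-even 1ℙ 0ℙ 0ℙ 1ℙ even _ = ⊥-elim (2∤1 even)
one-even 1ℙ 0ℙ 1ℙ 0ℙ even _ = ⊥-elim (2∤1 even)
one-even 1ℙ 1ℙ 1ℙ 1ℙ even _ = ⊥-elim (2∤1 even)

reduce-products : ∀ a b c e p q r s → ∃ λ k →
  (a * + 2 + p) * (b * + 2 + q) + (c * + 2 + r) * (e * + 2 + s) - + 1 ≡ k * + 2 + (p * q + r * s - + 1)
reduce-products a b c e p q r s = a * b * + 2 + a * q + b * p + c * e * + 2 + c * s + e * r , expand a b c e p q r s
  where
  expand : ∀ a b c e p q r s → (a * + 2 + p) * (b * + 2 + q) + (c * + 2 + r) * (e * + 2 + s) - + 1
    ≡ (a * b * + 2 + a * q + b * p + c * e * + 2 + c * s + e * r) * + 2 + (p * q + r * s - + 1)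
  expand = solve-∀

reduce-sums : ∀ a b c e p q r s → ∃ λ k →
  (a * + 2 + p) + (b * + 2 + q) - (c * + 2 + r) - (e * + 2 + s) ≡ k * + 2 + (p + q - r - s)
reduce-sums a b c e p q r s = a + b - c - e , expand a b c e p q r s
  where
  expand : ∀ a b c e p q r s →
    (a * + 2 + p) + (b * + 2 + q) - (c * + 2 + r) - (e * + 2 + s) ≡ (a + b - c - e) * + 2 + (p + q - r - s)
  expand = solve-∀

square-mod-16 : ∀ g U → ∃ λ N →
  (+ 4 * (g * g) - + 1 + + 8 * U) * (+ 4 * (g * g) - + 1 + + 8 * U) ≡ + 8 * (N * + 2 - g * g) + + 1
square-mod-16 g U = g * g * g * g + + 4 * U * U - U + + 4 * U * g * g , expand g U
  where
  expand : ∀ g U → (+ 4 * (g * g) - + 1 + + 8 * U) * (+ 4 * (g * g) - + 1 + + 8 * U)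
    ≡ + 8 * ((g * g * g * g + + 4 * U * U - U + + 4 * U * g * g) * + 2 - g * g) + + 1
  expand = solve-∀

record FactorResidues (x y z w : ℤ) : Set where
  constructor residues
  field
    V g N : ℤ
    f₀≡ : f₀ x y z w ≡ + 8 * V + + 3 + + 4 * (g * g)
    f₁²≡ : f₁ x y z w * f₁ x y z w ≡ + 8 * (N * + 2 - g * g) + + 1

first-even-residues : ∀ {x y z w} g → x * x ≡ + 4 * (g * g) → ∃ (λ s → y * y ≡ + 8 * s + + 1) →
  ∃ (λ t → z * z ≡ + 8 * t + + 1) → ∃ (λ u → w * w ≡ + 8 * u + + 1) → FactorResidues x y z w
first-even-residues {x} {y} {z} {w} g x² (s , y²) (t , z²) (u , w²) with square-mod-16 g (s - t - u)
... | N , f₁²≡ = residues (s + t + u) g N f₀≡ (trans (cong (λ f → f * f) f₁≡) f₁²≡)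
  where
  sum-identity : ∀ g s t u →
    + 4 * (g * g) + (+ 8 * s + + 1) + (+ 8 * t + + 1) + (+ 8 * u + + 1) ≡ + 8 * (s + t + u) + + 3 + + 4 * (g * g)
  sum-identity = solve-∀
  difference-identity : ∀ g s t u →
    + 4 * (g * g) + (+ 8 * s + + 1) - (+ 8 * t + + 1) - (+ 8 * u + + 1) ≡ + 4 * (g * g) - + 1 + + 8 * (s - t - u)
  difference-identity = solve-∀
  f₀≡ : f₀ x y z w ≡ + 8 * (s + t + u) + + 3 + + 4 * (g * g)
  f₀≡ rewrite x² | y² | z² | w² = sum-identity g s t u
  f₁≡ : f₁ x y z w ≡ + 4 * (g * g) - + 1 + + 8 * (s - t - u)
  f₁≡ rewrite x² | y² | z² | w² = difference-identity g s t u

residues-swap₁₂ : ∀ {x y z w} → FactorResidues y x z w → FactorResidues x y z w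
residues-swap₁₂ {x} {y} {z} {w} (residues V g N f₀≡ f₁²≡) =
  residues V g N (trans (cong (λ t → t + z * z + w * w) x²+y²≡) f₀≡)
    (trans (cong (λ t → (t - z * z - w * w) * (t - z * z - w * w)) x²+y²≡) f₁²≡)
  where
  x²+y²≡ : x * x + y * y ≡ y * y + x * x
  x²+y²≡ = +-comm (x * x) (y * y)

residues-swap-pairs : ∀ {x y z w} → FactorResidues z w x y → FactorResidues x y z w
residues-swap-pairs {x} {y} {z} {w} (residues V g N f₀≡ f₁²≡) =
  residues V g N (trans (f₀-swap x y z w) f₀≡) (trans (f₁²-swap x y z w) f₁²≡)
  where
  f₀-swap : ∀ x y z w → x * x + y * y + z * z + w * w ≡ z * z + w * w + x * x + y * y
  f₀-swap = solve-∀
  f₁²-swap : ∀ x y z w → (x * x + y * y - z * z - w * w) * (x * x + y * y - z * z - w * w)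
    ≡ (z * z + w * w - x * x - y * y) * (z * z + w * w - x * x - y * y)
  f₁²-swap = solve-∀

factor-residues : ∀ x y z w → + 2 ∣ x * y + z * w - + 1 → ¬ (+ 2 ∣ x + y - z - w) → FactorResidues x y z w
factor-residues x y z w xy+zw-odd x+y-z-w-odd
  with split-parity x | split-parity y | split-parity z | split-parity w
... | a , p , refl | b , q , refl | c , r , refl | e , s , refl
  with one-even p q r s
    (2∣i⇒2∣j (reduce-products a b c e ⟦ p ⟧ ⟦ q ⟧ ⟦ r ⟧ ⟦ s ⟧) xy+zw-odd)
    (x+y-z-w-odd ∘ 2∣j⇒2∣i (reduce-sums a b c e ⟦ p ⟧ ⟦ q ⟧ ⟦ r ⟧ ⟦ s ⟧))
... | even₁ = first-even-residues a (even-square a) (odd-square b) (odd-square c) (odd-square e)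
... | even₂ = residues-swap₁₂ (first-even-residues b (even-square b) (odd-square a) (odd-square c) (odd-square e))
... | even₃ = residues-swap-pairs (first-even-residues c (even-square c) (odd-square e) (odd-square a) (odd-square b))
... | even₄ = residues-swap-pairs (residues-swap₁₂
                (first-even-residues e (even-square e) (odd-square c) (odd-square a) (odd-square b)))

0≤i*i : ∀ i → 0ℤ ≤ i * i
0≤i*i (+ n)    = subst (0ℤ ≤_) (sym (+◃n≡+n (n ℕ.* n))) (+≤+ z≤n)
0≤i*i -[1+ n ] = subst (0ℤ ≤_) (sym (+◃n≡+n (suc n ℕ.* suc n))) (+≤+ z≤n)

0≤f₀ : ∀ x y z w → 0ℤ ≤ f₀ x y z w
0≤f₀ x y z w = +-mono-≤ (+-mono-≤ (+-mono-≤ (0≤i*i x) (0≤i*i y)) (0≤i*i z)) (0≤i*i w)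

0≤4m-1⇒1≤m : ∀ m → 0ℤ ≤ + 4 * m - + 1 → + 1 ≤ m
0≤4m-1⇒1≤m (+ suc _) _ = +≤+ (s≤s z≤n)
0≤4m-1⇒1≤m (+ zero) ()
0≤4m-1⇒1≤m -[1+ _ ] ()

Classified : ℤ → ℤ → Set
Classified D P = (D ≡₂ + 0 → InSetOdd (P * P)) × (D ≡₂ + 1 → InSetEven (P * P))

classified : ∀ {x y z w} D → FactorResidues x y z w → 0ℤ ≤ f₀ x y z w - + 4 * D →
  Classified D ((f₀ x y z w - + 4 * D) * f₁ x y z w)
classified {x} {y} {z} {w} D (residues V g N f₀≡ f₁²≡) 0≤f₀-4D = odd , even
  where
  P m n : ℤ
  P = (f₀ x y z w - + 4 * D) * f₁ x y z w
  m = + 2 * V + + 1 + g * g - D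
  n = N * + 2 - g * g
  f₀-4D≡4m-1 : f₀ x y z w - + 4 * D ≡ + 4 * m - + 1
  f₀-4D≡4m-1 = trans (cong (_- + 4 * D) f₀≡) (expand V g D)
    where
    expand : ∀ V g D → + 8 * V + + 3 + + 4 * (g * g) - + 4 * D ≡ + 4 * (+ 2 * V + + 1 + g * g - D) - + 1
    expand = solve-∀
  P²≡ : P * P ≡ (+ 4 * m - + 1) * (+ 4 * m - + 1) * (+ 8 * n + + 1)
  P²≡ = trans (square-of-product (f₀ x y z w - + 4 * D) (f₁ x y z w)) (cong₂ (λ a b → a * a * b) f₀-4D≡4m-1 f₁²≡)
    where
    square-of-product : ∀ a b → a * b * (a * b) ≡ a * a * (b * b)
    square-of-product = solve-∀
  1≤m : + 1 ≤ m
  1≤m = 0≤4m-1⇒1≤m m (subst (0ℤ ≤_) f₀-4D≡4m-1 0≤f₀-4D)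
  m-n : ∃ λ k → m - n ≡ k * + 2 + (+ 1 - D)
  m-n = V - N + g * g , expand V g N D
    where
    expand : ∀ V g N D → + 2 * V + + 1 + g * g - D - (N * + 2 - g * g) ≡ (V - N + g * g) * + 2 + (+ 1 - D)
    expand = solve-∀
  odd : D ≡₂ + 0 → InSetOdd (P * P)
  odd D≡₂0 = m , n , 1≤m , ≡₂0⇒2∤1-i D D≡₂0 ∘ 2∣i⇒2∣j m-n , P²≡
  even : D ≡₂ + 1 → InSetEven (P * P)
  even D≡₂1 = m , n , 1≤m , 2∣j⇒2∣i m-n (≡₂1⇒2∣1-i D D≡₂1) , P²≡

f₀-of-differences : ∀ u₀ u₁ v₀ v₁ s₀ s₁ t₀ t₁ →
  (u₀ - u₁) * (u₀ - u₁) + (v₀ - v₁) * (v₀ - v₁) + (s₀ - s₁) * (s₀ - s₁) + (t₀ - t₁) * (t₀ - t₁)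
    ≡ (u₀ + u₁) * (u₀ + u₁) + (v₀ + v₁) * (v₀ + v₁) + (s₀ + s₁) * (s₀ + s₁) + (t₀ + t₁) * (t₀ + t₁)
      - + 4 * (u₀ * u₁ + v₀ * v₁ + s₀ * s₁ + t₀ * t₁)
f₀-of-differences = solve-∀

-- b_i = d_i + d_{i+4} + 2 (a_{i+8} + a_{i+12})
b-difference : ∀ a₀ a₁ a₂ a₃ a₄ a₅ a₆ a₇ a₈ a₉ a₁₀ a₁₁ a₁₂ a₁₃ a₁₄ a₁₅ → ∃ λ k →
  (a₀ + a₈ + (a₄ + a₁₂) + (a₂ + a₁₀ + (a₆ + a₁₄))) - (a₁ + a₉ + (a₅ + a₁₃) + (a₃ + a₁₁ + (a₇ + a₁₅)))
    ≡ k * + 2 + ((a₀ - a₈ + (a₂ - a₁₀)) + (a₄ - a₁₂ + (a₆ - a₁₄)) - (a₁ - a₉ + (a₃ - a₁₁)) - (a₅ - a₁₃ + (a₇ - a₁₅)))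
b-difference a₀ a₁ a₂ a₃ a₄ a₅ a₆ a₇ a₈ a₉ a₁₀ a₁₁ a₁₂ a₁₃ a₁₄ a₁₅ =
  a₈ + a₁₂ + a₁₀ + a₁₄ - a₉ - a₁₃ - a₁₁ - a₁₅ , expand a₀ a₁ a₂ a₃ a₄ a₅ a₆ a₇ a₈ a₉ a₁₀ a₁₁ a₁₂ a₁₃ a₁₄ a₁₅
  where
  expand : ∀ a₀ a₁ a₂ a₃ a₄ a₅ a₆ a₇ a₈ a₉ a₁₀ a₁₁ a₁₂ a₁₃ a₁₄ a₁₅ →
    (a₀ + a₈ + (a₄ + a₁₂) + (a₂ + a₁₀ + (a₆ + a₁₄))) - (a₁ + a₉ + (a₅ + a₁₃) + (a₃ + a₁₁ + (a₇ + a₁₅)))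
      ≡ (a₈ + a₁₂ + a₁₀ + a₁₄ - a₉ - a₁₃ - a₁₁ - a₁₅) * + 2
        + ((a₀ - a₈ + (a₂ - a₁₀)) + (a₄ - a₁₂ + (a₆ - a₁₄)) - (a₁ - a₉ + (a₃ - a₁₁)) - (a₅ - a₁₃ + (a₇ - a₁₅)))
  expand = solve-∀

lemma3p7 : (a : Fin 16 → ℤ) →
    ¬ ((bvec a (# 0) + bvec a (# 2)) ≡₂ (bvec a (# 1) + bvec a (# 3))) →
    dval (dvec a) ≡₂ + 1 →
    ((dstar (dvec a) ≡₂ + 0 → InSetOdd (F (dvec a) * F (dvec a)))
    × (dstar (dvec a) ≡₂ + 1 → InSetEven (F (dvec a) * F (dvec a))))
lemma3p7 a b-odd d-odd = subst (Classified (dstar e)) (sym F≡)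
  (classified (dstar e) (factor-residues x y z w d-odd x+y-z-w-odd) (subst (0ℤ ≤_) f₀-diff (0≤f₀ x′ y′ z′ w′)))
  where
  e : Fin 8 → ℤ
  e = dvec a
  x y z w : ℤ
  x = e (# 0) + e (# 2)
  y = e (# 4) + e (# 6)
  z = e (# 1) + e (# 3)
  w = e (# 5) + e (# 7)
  x′ y′ z′ w′ : ℤ
  x′ = e (# 0) - e (# 2)
  y′ = e (# 4) - e (# 6)
  z′ = e (# 1) - e (# 3)
  w′ = e (# 5) - e (# 7)
  f₀-diff : f₀ x′ y′ z′ w′ ≡ f₀ x y z w - + 4 * dstar e
  f₀-diff = f₀-of-differences (e (# 0)) (e (# 2)) (e (# 4)) (e (# 6)) (e (# 1)) (e (# 3)) (e (# 5)) (e (# 7))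
  F≡ : F e ≡ (f₀ x y z w - + 4 * dstar e) * f₁ x y z w
  F≡ = cong (_* f₁ x y z w) f₀-diff
  x+y-z-w-odd : ¬ (+ 2 ∣ x + y - z - w)
  x+y-z-w-odd = b-odd ∘ 2∣j⇒2∣i (b-difference (a (# 0)) (a (# 1)) (a (# 2)) (a (# 3)) (a (# 4)) (a (# 5))
    (a (# 6)) (a (# 7)) (a (# 8)) (a (# 9)) (a (# 10)) (a (# 11)) (a (# 12)) (a (# 13)) (a (# 14)) (a (# 15)))
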